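{- For every input $(V,\phi_0)$ with $V$ a finite set of propositional variables and $\phi_0\in\mathcal{L}^{ -*}$, the procedure $\mathrm{mcTableau}$ described below, started on the initial branch $b_0$ for $(V,\phi_0)$, halts.
   Context: $\mathsf{DL\text{ - }PA}$ syntax: $\mathbb{P}$ is a countable set of propositional variables; an assignment $\alpha$ is a non-empty finite partial function $\mathbb{P}\to\{\top,\bot\}$ with domain $\mathrm{dom}(\alpha)$. Formulas $\phi ::= p \mid \neg\phi \mid \phi\wedge\phi \mid [\pi]\phi$, programs $\pi ::= \alpha \mid \pi;\pi \mid \pi\cup\pi \mid \pi^* \mid \phi?$; $\mathcal{L}^{ -*}$ is the set of formulas without ${}^*$. $\mathbb{P}_{\phi_0}$ is the set of variables occurring in $\phi_0$ (including those in domains of assignments occurring in $\phi_0$). A labelled formula is $\langle\sigma,\phi\rangle$ with $\sigma$ a finite (possibly empty) sequence of assignments; a branch is a set of labelled formulas. Initial branch: $b_0=\{\langle(),p\rangle:p\in\mathbb{P}_{\phi_0}\cap V\}\cup\{\langle(),\neg p\rangle:p\in\mathbb{P}_{\phi_0}\setminus V\}\cup\{\langle(),\phi_0\rangle\}$. Rules (a witness $\lambda\in b$ yields sets $b_1,\dots,b_k$): R$\neg$: $\langle\sigma,\neg\neg\phi\rangle\mapsto\{\langle\sigma,\phi\rangle\}$; R$\wedge$: $\langle\sigma,\phi\wedge\psi\rangle\mapsto\{\langle\sigma,\phi\rangle,\langle\sigma,\psi\rangle\}$; R$\vee$: $\langle\sigma,\neg(\phi\wedge\psi)\rangle\mapsto\{\langle\sigma,\neg\phi\rangle\}\mid\{\langle\sigma,\neg\psi\rangle\}$;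 R$[\alpha]$: $\langle\sigma,[\alpha]\phi\rangle\mapsto\{\langle\sigma\alpha,\phi\rangle\}\cup\{\langle\sigma\alpha,p\rangle:\alpha(p)=\top\}\cup\{\langle\sigma\alpha,\neg p\rangle:\alpha(p)=\bot\}$; R$\langle\alpha\rangle$: $\langle\sigma,\neg[\alpha]\phi\rangle\mapsto\{\langle\sigma\alpha,\neg\phi\rangle\}\cup\{\langle\sigma\alpha,p\rangle:\alpha(p)=\top\}\cup\{\langle\sigma\alpha,\neg p\rangle:\alpha(p)=\bot\}$; R$[?]$: $\langle\sigma,[\psi?]\phi\rangle\mapsto\{\langle\sigma,\neg\psi\rangle\}\mid\{\langle\sigma,\phi\rangle\}$; R$\langle?\rangle$: $\langle\sigma,\neg[\psi?]\phi\rangle\mapsto\{\langle\sigma,\psi\rangle,\langle\sigma,\neg\phi\rangle\}$; R$[;]$: $\langle\sigma,[\pi_1;\pi_2]\phi\rangle\mapsto\{\langle\sigma,[\pi_1][\pi_2]\phi\rangle\}$; R$\langle;\rangle$: $\langle\sigma,\neg[\pi_1;\pi_2]\phi\rangle\mapsto\{\langle\sigma,\neg[\pi_1][\pi_2]\phi\rangle\}$; R$[\cup]$: $\langle\sigma,[\pi_1\cup\pi_2]\phi\rangle\mapsto\{\langle\sigma,[\pi_1]\phi\rangle,\langle\sigma,[\pi_2]\phi\rangle\}$; R$\langle\cup\rangle$: $\langle\sigma,\neg[\pi_1\cup\pi_2]\phi\rangle\mapsto\{\langle\sigma,\neg[\pi_1]\phi\rangle\}\mid\{\langle\sigma,\neg[\pi_2]\phi\rangle\}$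 (where "$\mid$" separates the $k=2$ alternatives); RP1: witness $\langle\sigma,p\rangle$ with some $\langle\sigma\alpha,\psi\rangle\in b$, $p\notin\mathrm{dom}(\alpha)$, yields $\{\langle\sigma\alpha,p\rangle\}$; RP2: same with $\neg p$ yielding $\{\langle\sigma\alpha,\neg p\rangle\}$. Labelled formulas can be marked "non-applicable"; an applicable witness is an unmarked labelled formula to which a rule applies. Procedure $\mathrm{mcTableau}(b)$, returning true/false: (i) if $b$ has an applicable witness $\lambda$ to one of R$\neg$, R$\wedge$, R$\langle?\rangle$, R$[;]$, R$\langle;\rangle$, R$[\cup]$, with generated set $b_1$: mark $\lambda$ and return $\mathrm{mcTableau}(b\cup b_1)$; (ii) else if $b$ has an applicable witness $\lambda$ to one of R$\vee$, R$[?]$, R$\langle\cup\rangle$, with generated sets $b_1,\dots,b_k$: mark $\lambda$; for $i=1,\dots,k$, if $\mathrm{mcTableau}(b\cup b_i)$ returns true then return true; otherwise return false; (iii) else, while there are an assignment $\alpha$ and an applicable witness $\lambda=\langle\sigma,[\alpha]\psi\rangle$ or $\langle\sigma,\neg[\alpha]\psi\rangle$ in $b$: let $b_1$ be the set generated by R$[\alpha]$ resp. R$\langle\alpha\rangle$ from $\lambda$ and mark $\lambda$; for every further applicable witness $\lambda'\in b$ of form $\langle\sigma,[\alpha]\psi'\rangle$ or $\langle\sigma,\neg[\alpha]\psi'\rangle$ (same $\sigma,\alpha$), add to $b_1$ the set generated from $\lambda'$ and mark $\lambda'$; then while $b\cup b_1$ contains an applicable witness to RP1 or RP2, add the generated labelled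 formula to $b_1$ and mark that witness; then if $\mathrm{mcTableau}(b_1)$ returns false, return false. When the loop ends, return true. -}

module Defs where

open import Data.Nat using (ℕ; _<_)
open import Data.Bool using (Bool; true; false)
open import Data.Product using (Σ; _×_; _,_; proj₁)
open import Data.Sum using (_⊎_)
open import Data.Empty using (⊥)
open import Data.List using (List; []; _∷_; _++_; [_]; map)
open import Data.List.Membership.Propositional using (_∈_; _∉_)
open import Data.List.Relation.Unary.Linked using (Linked)
open import Relation.Binary.PropositionalEquality using (_≡_; _≢_)
open import Relation.Nullary using (¬_)

-- An assignment: a non-empty finite partial function ℕ → {⊤,⊥},
-- represented canonically as its graph, listed with strictly
-- increasing variables (so equal functions are equal objects).
record Assignment : Set where
  constructor mkAsg
  field
    pairs     : List (ℕ × Bool)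
    .nonEmpty : pairs ≢ []
    .sorted   : Linked _<_ (map proj₁ pairs)
open Assignment public

dom : Assignment → List ℕ
dom α = map proj₁ (pairs α)

mutual
  data Form : Set where
    var  : ℕ → Form
    ¬'_  : Form → Form
    _∧'_ : Form → Form → Form
    ⟪_⟫_ : Prog → Form → Form

  data Prog : Set where
    asg  : Assignment → Prog
    _；_ : Prog → Prog → Prog
    _∪'_ : Prog → Prog → Prog
    _*'  : Prog → Prog
    _¿   : Form → Prog

mutual
  data StarFreeF : Form → Set where
    var : ∀ {p} → StarFreeF (var p)
    neg : ∀ {φ} → StarFreeF φ → StarFreeF (¬' φ)
    conj : ∀ {φ ψ} → StarFreeF φ → StarFreeF ψ → StarFreeF (φ ∧' ψ)
    box : ∀ {π φ} → StarFreeP π → StarFreeF φ → StarFreeF (⟪ π ⟫ φ)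

  data StarFreeP : Prog → Set where
    asg : ∀ {α} → StarFreeP (asg α)
    seq : ∀ {π₁ π₂} → StarFreeP π₁ → StarFreeP π₂ → StarFreeP (π₁ ； π₂)
    cup : ∀ {π₁ π₂} → StarFreeP π₁ → StarFreeP π₂ → StarFreeP (π₁ ∪' π₂)
    test : ∀ {ψ} → StarFreeF ψ → StarFreeP (ψ ¿)

mutual
  varsF : Form → List ℕ
  varsF (var p)   = p ∷ []
  varsF (¬' φ)    = varsF φ
  varsF (φ ∧' ψ)  = varsF φ ++ varsF ψ
  varsF (⟪ π ⟫ φ) = varsP π ++ varsF φ

  varsP : Prog → List ℕ
  varsP (asg α)    = dom α
  varsP (π₁ ； π₂) = varsP π₁ ++ varsP π₂
  varsP (π₁ ∪' π₂) = varsP π₁ ++ varsP π₂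
  varsP (π *')     = varsP π
  varsP (ψ ¿)      = varsF ψ

Label : Set
Label = List Assignment

LF : Set
LF = Label × Form

Pred : Set₁
Pred = LF → Set

_∪ₚ_ : Pred → Pred → Pred
(A ∪ₚ B) x = A x ⊎ B x

｛_｝ : LF → Pred
｛ a ｝ x = x ≡ a

⟦_⟧ : List LF → Pred
⟦ xs ⟧ x = x ∈ xs

∅ : Pred
∅ _ = ⊥

-- A branch together with the set of its marked ("non-applicable")
-- labelled formulas.
record Br : Set₁ where
  constructor br
  field
    mem  : Pred
    mark : Pred
open Br public

App : Br → LF → Set
App b l = mem b l × ¬ mark b l

data WI : LF → Set where
  r¬   : ∀ {σ φ} → WI (σ , ¬' (¬' φ))
  r∧   : ∀ {σ φ ψ} → WI (σ , φ ∧' ψ)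
  r⟨?⟩ : ∀ {σ ψ φ} → WI (σ , ¬' (⟪ ψ ¿ ⟫ φ))
  r[seq] : ∀ {σ π₁ π₂ φ} → WI (σ , ⟪ π₁ ； π₂ ⟫ φ)
  r⟨seq⟩ : ∀ {σ π₁ π₂ φ} → WI (σ , ¬' (⟪ π₁ ； π₂ ⟫ φ))
  r[∪] : ∀ {σ π₁ π₂ φ} → WI (σ , ⟪ π₁ ∪' π₂ ⟫ φ)

genI : ∀ {l} → WI l → Pred
genI (r¬ {σ} {φ})               = ⟦ (σ , φ) ∷ [] ⟧
genI (r∧ {σ} {φ} {ψ})           = ⟦ (σ , φ) ∷ (σ , ψ) ∷ [] ⟧
genI (r⟨?⟩ {σ} {ψ} {φ})         = ⟦ (σ , ψ) ∷ (σ , ¬' φ) ∷ [] ⟧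
genI (r[seq] {σ} {π₁} {π₂} {φ})   = ⟦ (σ , ⟪ π₁ ⟫ (⟪ π₂ ⟫ φ)) ∷ [] ⟧
genI (r⟨seq⟩ {σ} {π₁} {π₂} {φ})   = ⟦ (σ , ¬' (⟪ π₁ ⟫ (⟪ π₂ ⟫ φ))) ∷ [] ⟧
genI (r[∪] {σ} {π₁} {π₂} {φ})   = ⟦ (σ , ⟪ π₁ ⟫ φ) ∷ (σ , ⟪ π₂ ⟫ φ) ∷ [] ⟧

data WII : LF → Set where
  r∨    : ∀ {σ φ ψ} → WII (σ , ¬' (φ ∧' ψ))
  r[?]  : ∀ {σ ψ φ} → WII (σ , ⟪ ψ ¿ ⟫ φ)
  r⟨∪⟩  : ∀ {σ π₁ π₂ φ} → WII (σ , ¬' (⟪ π₁ ∪' π₂ ⟫ φ))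

genII₁ genII₂ : ∀ {l} → WII l → Pred
genII₁ (r∨ {σ} {φ} {ψ})          = ⟦ (σ , ¬' φ) ∷ [] ⟧
genII₁ (r[?] {σ} {ψ} {φ})        = ⟦ (σ , ¬' ψ) ∷ [] ⟧
genII₁ (r⟨∪⟩ {σ} {π₁} {π₂} {φ})  = ⟦ (σ , ¬' (⟪ π₁ ⟫ φ)) ∷ [] ⟧
genII₂ (r∨ {σ} {φ} {ψ})          = ⟦ (σ , ¬' ψ) ∷ [] ⟧
genII₂ (r[?] {σ} {ψ} {φ})        = ⟦ (σ , φ) ∷ [] ⟧
genII₂ (r⟨∪⟩ {σ} {π₁} {π₂} {φ})  = ⟦ (σ , ¬' (⟪ π₂ ⟫ φ)) ∷ [] ⟧

data WA : LF → Label → Assignment → Set where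
  r[α] : ∀ {σ α φ} → WA (σ , ⟪ asg α ⟫ φ) σ α
  r⟨α⟩ : ∀ {σ α φ} → WA (σ , ¬' (⟪ asg α ⟫ φ)) σ α

effects : Label → Assignment → Pred
effects σ α x =
  Σ ℕ (λ p → ((p , true) ∈ pairs α × x ≡ (σ ++ [ α ] , var p))
           ⊎ ((p , false) ∈ pairs α × x ≡ (σ ++ [ α ] , ¬' var p)))

genA : ∀ {l σ α} → WA l σ α → Pred
genA (r[α] {σ} {α} {φ}) = ｛ (σ ++ [ α ] , φ) ｝ ∪ₚ effects σ α
genA (r⟨α⟩ {σ} {α} {φ}) = ｛ (σ ++ [ α ] , ¬' φ) ｝ ∪ₚ effects σ α

-- RP1 / RP2 relative to a set B: witness l generates the single
-- labelled formula given as the third index.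
data WRP (B : Pred) : LF → LF → Set where
  rp1 : ∀ {σ α ψ p} → B (σ ++ [ α ] , ψ) → p ∉ dom α →
        WRP B (σ , var p) (σ ++ [ α ] , var p)
  rp2 : ∀ {σ α ψ p} → B (σ ++ [ α ] , ψ) → p ∉ dom α →
        WRP B (σ , ¬' var p) (σ ++ [ α ] , ¬' var p)

NoI : Br → Set
NoI b = ∀ l → WI l → ¬ App b l

NoII : Br → Set
NoII b = ∀ l → WII l → ¬ App b l

NoA : Br → Set
NoA b = ∀ l σ α → WA l σ α → ¬ App b l

extend : Br → LF → Pred → Br
extend b l g = br (mem b ∪ₚ g) (mark b ∪ₚ ｛ l ｝)

-- step (iii): the witnesses treated together for (σ, α) (all applicable
-- witnesses with that label and assignment), the set b₁ they generate,
-- and the marks after marking them.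
B₁ : Br → Label → Assignment → Pred
B₁ b σ α x = Σ LF (λ l → App b l × Σ (WA l σ α) (λ w → genA w x))

M₁ : Br → Label → Assignment → Pred
M₁ b σ α = mark b ∪ₚ (λ l → App b l × WA l σ α)

-- RP closure loop: state (B, M) = (current b₁, current marks);
-- P = the (fixed) current branch b.  CloseOut P B M B' M' : some run of
-- the closure loop ends in (B', M').
data CloseOut (P : Pred) : Pred → Pred → Pred → Pred → Set₁ where
  cdone : ∀ {B M} →
          (∀ l ℓ → (P ∪ₚ B) l → ¬ M l → ¬ WRP (P ∪ₚ B) l ℓ) →
          CloseOut P B M B M
  cstep : ∀ {B M B' M' l ℓ} → (P ∪ₚ B) l → ¬ M l → WRP (P ∪ₚ B) l ℓ →
          CloseOut P (B ∪ₚ ｛ ℓ ｝) (M ∪ₚ ｛ l ｝) B' M' →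
          CloseOut P B M B' M'

data CloseTerm (P : Pred) : Pred → Pred → Set₁ where
  cterm : ∀ {B M} →
          (∀ l ℓ → (P ∪ₚ B) l → ¬ M l → WRP (P ∪ₚ B) l ℓ →
             CloseTerm P (B ∪ₚ ｛ ℓ ｝) (M ∪ₚ ｛ l ｝)) →
          CloseTerm P B M

-- Out b r : some (finite) run of mcTableau(b) returns r.
-- LoopOut b r : some run of the while-loop of step (iii) from b returns r.
mutual
  data Out : Br → Bool → Set₁ where
    outI   : ∀ {b l r} (w : WI l) → App b l →
             Out (extend b l (genI w)) r → Out b r
    outII₁ : ∀ {b l} → NoI b → (w : WII l) → App b l →
             Out (extend b l (genII₁ w)) true → Out b true
    outII₂ : ∀ {b l r} → NoI b → (w : WII l) → App b l →
             Out (extend b l (genII₁ w)) false →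
             Out (extend b l (genII₂ w)) r → Out b r
    outIII : ∀ {b r} → NoI b → NoII b → LoopOut b r → Out b r

  data LoopOut : Br → Bool → Set₁ where
    lend  : ∀ {b} → NoA b → LoopOut b true
    lfail : ∀ {b l σ α B' M'} → WA l σ α → App b l →
            CloseOut (mem b) (B₁ b σ α) (M₁ b σ α) B' M' →
            Out (br B' M') false → LoopOut b false
    lnext : ∀ {b l σ α B' M' r} → WA l σ α → App b l →
            CloseOut (mem b) (B₁ b σ α) (M₁ b σ α) B' M' →
            Out (br B' M') true → LoopOut (br (mem b) M') r → LoopOut b r

-- Halts b : every run of mcTableau(b) halts (for every choice of
-- witnesses); LoopHalts likewise for the loop of step (iii).
mutual
  data Halts : Br → Set₁ where
    halts : ∀ {b} →
      (∀ l (w : WI l) → App b l → Halts (extend b l (genI w))) →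
      (NoI b → ∀ l (w : WII l) → App b l →
         Halts (extend b l (genII₁ w)) ×
         (Out (extend b l (genII₁ w)) false → Halts (extend b l (genII₂ w)))) →
      (NoI b → NoII b → LoopHalts b) →
      Halts b

  data LoopHalts : Br → Set₁ where
    lhalts : ∀ {b} →
      (∀ l σ α → WA l σ α → App b l →
         CloseTerm (mem b) (B₁ b σ α) (M₁ b σ α) ×
         (∀ B' M' → CloseOut (mem b) (B₁ b σ α) (M₁ b σ α) B' M' →
            Halts (br B' M') ×
            (Out (br B' M') true → LoopHalts (br (mem b) M')))) →
      LoopHalts b

b₀ : List ℕ → Form → Br
b₀ V φ₀ = br mem₀ ∅
  where
  mem₀ : Pred
  mem₀ x = x ≡ ([] , φ₀)
         ⊎ Σ ℕ (λ p → p ∈ varsF φ₀ × p ∈ V × x ≡ ([] , var p))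
         ⊎ Σ ℕ (λ p → p ∈ varsF φ₀ × p ∉ V × x ≡ ([] , ¬' var p))

module Submission where

-- Every formula φ gets a weight pair (weight of φ, weight of ¬φ), chosen so that
-- each formula generated by a rule from a witness ⟨σ,φ⟩ is lighter than φ, and
-- literals are weightless.  The run is then controlled by a list L of labelled
-- formulas ("tracking" the branch b) that contains every unmarked member of b;
-- all members of b carry one label σ.  Then
--   * steps (i)/(ii) mark the witness and add lighter formulas, so the total
--     weight of the tracking list drops (extend-tracked);
--   * in step (iii) the RP closure loop only copies unmarked literals of b to
--     the new label σα, hence halts (closure-terminates), and the branch it
--     produces is tracked by the successors of L, which weigh strictly less than
--     L (after-closure, successors-lighter); the next round of the while loop
--     runs on b with one more witness marked, tracked by L minus that witness.
-- A mutual induction on the total weight and on the length of L (tableau-halts,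
-- loop-halts) yields Halts b₀.  Star formulas are inert: no rule applies to
-- them.

open import Defs
open import Data.Nat using (ℕ; zero; suc; _+_; _≤_; _<_; z≤n; s≤s; s≤s⁻¹)
open import Data.Nat.Properties
  using (≤-refl; ≤-reflexive; ≤-trans; <-≤-trans; <⇒≤; +-identityʳ; m≤m+n; m≤n+m;
         +-mono-≤; +-mono-<-≤; +-mono-≤-<; +-monoʳ-<; +-comm; +-commutativeSemigroup;
         module ≤-Reasoning)
open import Algebra.Properties.CommutativeSemigroup +-commutativeSemigroup using (x∙yz≈y∙xz)
open import Data.Nat.ListAction using (sum)
open import Data.Nat.ListAction.Properties using (sum-++)
open import Data.Bool using (Bool; true; false)
open import Data.Empty using (⊥-elim)
open import Data.Product using (Σ; _×_; _,_; proj₁; proj₂; swap)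
open import Data.Sum using (_⊎_; inj₁; inj₂)
open import Data.List using (List; []; _∷_; _++_; [_]; map; length; concatMap)
open import Data.List.Properties using (map-++; ++-assoc; ++-identityʳ-unique; length-removeAt′)
open import Data.List.Relation.Unary.All using (All; []; _∷_) renaming (lookup to All-lookup)
open import Data.List.Relation.Unary.Any using (here; there; index; _─_)
open import Data.List.Membership.Propositional using (_∈_; lose)
open import Data.List.Membership.Propositional.Properties
  using (∈-++⁺ˡ; ∈-++⁺ʳ; ∈-map⁺; ∈-concatMap⁺)
open import Relation.Binary.PropositionalEquality
  using (_≡_; _≢_; refl; sym; trans; cong; module ≡-Reasoning)
open import Relation.Nullary using (¬_)

_⊕_ : ℕ × ℕ → ℕ × ℕ → ℕ × ℕ
(a , n) ⊕ (a' , n') = suc (a + a') , suc (n + n')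

negated : ℕ × ℕ → ℕ × ℕ
negated (a , n) = n , suc a

bump : ℕ × ℕ → ℕ × ℕ
bump (a , n) = suc a , suc n

mutual
  -- weights φ = (weight of φ, weight of ¬φ).
  weights : Form → ℕ × ℕ
  weights (var p)   = 0 , 0
  weights (¬' φ)    = negated (weights φ)
  weights (φ ∧' ψ)  = weights φ ⊕ weights ψ
  weights (⟪ π ⟫ φ) = boxWeights π (weights φ)

  -- The weights of [π]φ, given the weights q of φ.  The test ψ? swaps the
  -- components of ψ, since R[?] produces ¬ψ and R⟨?⟩ produces ψ.
  boxWeights : Prog → ℕ × ℕ → ℕ × ℕ
  boxWeights (asg α)    q = bump q
  boxWeights (π₁ ； π₂) q = bump (boxWeights π₁ (boxWeights π₂ q))
  boxWeights (π₁ ∪' π₂) q = boxWeights π₁ q ⊕ boxWeights π₂ q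
  boxWeights (π *')     q = 0 , 0
  boxWeights (ψ ¿)      q = swap (weights ψ) ⊕ q

weight : LF → ℕ
weight (_ , φ) = proj₁ (weights φ)

total : List LF → ℕ
total xs = sum (map weight xs)

total-++ : ∀ xs ys → total (xs ++ ys) ≡ total xs + total ys
total-++ xs ys = trans (cong sum (map-++ weight xs ys)) (sum-++ (map weight xs) (map weight ys))

total-─ : ∀ {x L} (i : x ∈ L) → weight x + total (L ─ i) ≡ total L
total-─ (here refl) = refl
total-─ {x} {y ∷ L} (there i) =
  trans (x∙yz≈y∙xz (weight x) (weight y) _) (cong (weight y +_) (total-─ i))

total-─-≤ : ∀ {x : LF} {L} (i : x ∈ L) → total (L ─ i) ≤ total L
total-─-≤ {x} i = ≤-trans (m≤n+m _ (weight x)) (≤-reflexive (total-─ i))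

─-shorter : ∀ {x : LF} {L} (i : x ∈ L) → length (L ─ i) < length L
─-shorter {L = L} i = ≤-reflexive (sym (length-removeAt′ L (index i)))

∈-─ : ∀ {x y : LF} {L} (i : x ∈ L) → y ∈ L → y ≢ x → y ∈ (L ─ i)
∈-─ (here refl) (here refl) y≢x = ⊥-elim (y≢x refl)
∈-─ (here refl) (there j)   _   = j
∈-─ (there i)   (here refl) _   = here refl
∈-─ (there i)   (there j)   y≢x = there (∈-─ i j y≢x)

concatMap-light : (f : LF → List LF) → (∀ x → total (f x) ≤ weight x) →
                  ∀ L → total (concatMap f L) ≤ total L
concatMap-light f light []      = z≤n
concatMap-light f light (x ∷ L) =
  ≤-trans (≤-reflexive (total-++ (f x) (concatMap f L))) (+-mono-≤ (light x) (concatMap-light f light L))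

concatMap-lighter : (f : LF → List LF) → (∀ x → total (f x) ≤ weight x) →
                    ∀ {y L} → y ∈ L → total (f y) < weight y → total (concatMap f L) < total L
concatMap-lighter f light {L = x ∷ L} (here refl) lt =
  <-≤-trans (≤-reflexive (cong suc (total-++ (f x) (concatMap f L))))
            (+-mono-<-≤ lt (concatMap-light f light L))
concatMap-lighter f light {L = x ∷ L} (there i) lt =
  <-≤-trans (≤-reflexive (cong suc (total-++ (f x) (concatMap f L))))
            (+-mono-≤-< (light x) (concatMap-lighter f light i lt))

Labelled : Label → Pred → Set
Labelled σ A = ∀ x → A x → proj₁ x ≡ σ

record Lighter (l : LF) (G : Pred) : Set₁ where
  constructor lighter
  field
    list      : List LF
    denotes   : G ≡ ⟦ list ⟧
    sameLabel : All (λ x → proj₁ x ≡ proj₁ l) list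
    decreases : total list < weight l

single-lighter : ∀ x {w} → weight x < w → total [ x ] < w
single-lighter x = <-≤-trans (s≤s (≤-reflexive (+-identityʳ (weight x))))

pair-lighter : ∀ x y → total (x ∷ y ∷ []) < suc (weight x + weight y)
pair-lighter x y = s≤s (≤-reflexive (cong (weight x +_) (+-identityʳ (weight y))))

ruleI-lighter : ∀ {l} (w : WI l) → Lighter l (genI w)
ruleI-lighter (r¬ {σ} {φ}) =
  lighter _ refl (refl ∷ []) (single-lighter (σ , φ) ≤-refl)
ruleI-lighter (r∧ {σ} {φ} {ψ}) =
  lighter _ refl (refl ∷ refl ∷ []) (pair-lighter (σ , φ) (σ , ψ))
ruleI-lighter (r⟨?⟩ {σ} {ψ} {φ}) =
  lighter _ refl (refl ∷ refl ∷ []) (pair-lighter (σ , ψ) (σ , ¬' φ))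
ruleI-lighter (r[seq] {σ} {π₁} {π₂} {φ}) =
  lighter _ refl (refl ∷ []) (single-lighter (σ , ⟪ π₁ ⟫ (⟪ π₂ ⟫ φ)) ≤-refl)
ruleI-lighter (r⟨seq⟩ {σ} {π₁} {π₂} {φ}) =
  lighter _ refl (refl ∷ []) (single-lighter (σ , ¬' (⟪ π₁ ⟫ (⟪ π₂ ⟫ φ))) ≤-refl)
ruleI-lighter (r[∪] {σ} {π₁} {π₂} {φ}) =
  lighter _ refl (refl ∷ refl ∷ []) (pair-lighter (σ , ⟪ π₁ ⟫ φ) (σ , ⟪ π₂ ⟫ φ))

ruleII-lighter₁ : ∀ {l} (w : WII l) → Lighter l (genII₁ w)
ruleII-lighter₁ (r∨ {σ} {φ} {ψ}) =
  lighter _ refl (refl ∷ []) (single-lighter (σ , ¬' φ) (s≤s (m≤m+n _ _)))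
ruleII-lighter₁ (r[?] {σ} {ψ} {φ}) =
  lighter _ refl (refl ∷ []) (single-lighter (σ , ¬' ψ) (s≤s (m≤m+n _ _)))
ruleII-lighter₁ (r⟨∪⟩ {σ} {π₁} {π₂} {φ}) =
  lighter _ refl (refl ∷ []) (single-lighter (σ , ¬' (⟪ π₁ ⟫ φ)) (s≤s (m≤m+n _ _)))

ruleII-lighter₂ : ∀ {l} (w : WII l) → Lighter l (genII₂ w)
ruleII-lighter₂ (r∨ {σ} {φ} {ψ}) =
  lighter _ refl (refl ∷ []) (single-lighter (σ , ¬' ψ) (s≤s (m≤n+m _ _)))
ruleII-lighter₂ (r[?] {σ} {ψ} {φ}) =
  lighter _ refl (refl ∷ []) (single-lighter (σ , φ) (s≤s (m≤n+m _ _)))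
ruleII-lighter₂ (r⟨∪⟩ {σ} {π₁} {π₂} {φ}) =
  lighter _ refl (refl ∷ []) (single-lighter (σ , ¬' (⟪ π₂ ⟫ φ)) (s≤s (m≤n+m _ _)))

_⊆ₚ_ : Pred → Pred → Set
A ⊆ₚ B = ∀ x → A x → B x

Covers : List LF → Pred → Pred → Set
Covers L A M = ∀ x → A x → ¬ M x → x ∈ L

covers-mark : ∀ {L A M l} → Covers L A M → (i : l ∈ L) → Covers (L ─ i) A (M ∪ₚ ｛ l ｝)
covers-mark cov i x ax unmarked = ∈-─ i (cov x ax (λ m → unmarked (inj₁ m))) (λ e → unmarked (inj₂ e))

covers-weaken : ∀ {L A M N} → M ⊆ₚ N → Covers L A M → Covers L A N
covers-weaken M⊆N cov x ax unmarked = cov x ax (λ m → unmarked (M⊆N x m))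

labelled-add : ∀ {σ A y} → Labelled σ A → proj₁ y ≡ σ → Labelled σ (A ∪ₚ ｛ y ｝)
labelled-add lab e x (inj₁ ax)   = lab x ax
labelled-add lab e x (inj₂ refl) = e

within-add : ∀ {A L y} → A ⊆ₚ ⟦ L ⟧ → y ∈ L → (A ∪ₚ ｛ y ｝) ⊆ₚ ⟦ L ⟧
within-add A⊆L y∈L x (inj₁ ax)   = A⊆L x ax
within-add A⊆L y∈L x (inj₂ refl) = y∈L

record Tracked (b : Br) (σ : Label) (L : List LF) : Set where
  constructor tracked
  field
    labelled : Labelled σ (mem b)
    covered  : Covers L (mem b) (mark b)

  position : ∀ {l} → App b l → l ∈ L
  position (inb , unmarked) = covered _ inb unmarked
open Tracked

extend-tracked : ∀ {b σ L l G} → Tracked b σ L → App b l → Lighter l G →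
                 Σ (List LF) λ L' → Tracked (extend b l G) σ L' × total L' < total L
extend-tracked {b} {σ} {L} {l} t app@(inb , _) (lighter g refl same decreases) =
  (L ─ i) ++ g , tracked labelled' covered' , lighter-list
  where
  i : l ∈ L
  i = position t app
  labelled' : Labelled σ (mem b ∪ₚ ⟦ g ⟧)
  labelled' x (inj₁ bx) = labelled t x bx
  labelled' x (inj₂ gx) = trans (All-lookup same gx) (labelled t l inb)
  covered' : Covers ((L ─ i) ++ g) (mem b ∪ₚ ⟦ g ⟧) (mark b ∪ₚ ｛ l ｝)
  covered' x (inj₁ bx) unmarked = ∈-++⁺ˡ (covers-mark (covered t) i x bx unmarked)
  covered' x (inj₂ gx) _        = ∈-++⁺ʳ (L ─ i) gx
  lighter-list : total ((L ─ i) ++ g) < total L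
  lighter-list = begin-strict
    total ((L ─ i) ++ g)     ≡⟨ total-++ (L ─ i) g ⟩
    total (L ─ i) + total g  <⟨ +-monoʳ-< (total (L ─ i)) decreases ⟩
    total (L ─ i) + weight l ≡⟨ +-comm (total (L ─ i)) (weight l) ⟩
    weight l + total (L ─ i) ≡⟨ total-─ i ⟩
    total L                  ∎
    where open ≤-Reasoning

-- An assignment formula contributes its successor (R[α], R⟨α⟩), a literal
-- its copy at τ (RP1, RP2); nothing else is carried over.
transfer : Label → LF → List LF
transfer τ (_ , var p)            = [ τ , var p ]
transfer τ (_ , ¬' var p)         = [ τ , ¬' var p ]
transfer τ (σ , ⟪ asg α ⟫ φ)      = [ σ ++ [ α ] , φ ]
transfer τ (σ , ¬' (⟪ asg α ⟫ φ)) = [ σ ++ [ α ] , ¬' φ ]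
transfer τ _                      = []

transfer-strict : ∀ τ {l σ α} → WA l σ α → total (transfer τ l) < weight l
transfer-strict τ (r[α] {σ} {α} {φ}) = single-lighter (σ ++ [ α ] , φ) ≤-refl
transfer-strict τ (r⟨α⟩ {σ} {α} {φ}) = single-lighter (σ ++ [ α ] , ¬' φ) ≤-refl

-- Literals are weightless, so transfer never increases weight.
transfer-light : ∀ τ x → total (transfer τ x) ≤ weight x
transfer-light τ (_ , var _)               = z≤n
transfer-light τ (_ , ¬' var _)            = z≤n
transfer-light τ (_ , ¬' (¬' _))           = z≤n
transfer-light τ (_ , ¬' (_ ∧' _))         = z≤n
transfer-light τ x@(_ , ¬' (⟪ asg _ ⟫ _)) = <⇒≤ (transfer-strict τ {x} r⟨α⟩)
transfer-light τ (_ , ¬' (⟪ _ ； _ ⟫ _))   = z≤n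
transfer-light τ (_ , ¬' (⟪ _ ∪' _ ⟫ _))   = z≤n
transfer-light τ (_ , ¬' (⟪ _ *' ⟫ _))     = z≤n
transfer-light τ (_ , ¬' (⟪ _ ¿ ⟫ _))      = z≤n
transfer-light τ (_ , _ ∧' _)              = z≤n
transfer-light τ x@(_ , ⟪ asg _ ⟫ _)      = <⇒≤ (transfer-strict τ {x} r[α])
transfer-light τ (_ , ⟪ _ ； _ ⟫ _)        = z≤n
transfer-light τ (_ , ⟪ _ ∪' _ ⟫ _)        = z≤n
transfer-light τ (_ , ⟪ _ *' ⟫ _)          = z≤n
transfer-light τ (_ , ⟪ _ ¿ ⟫ _)           = z≤n

effectLiteral : Label → Assignment → ℕ × Bool → LF
effectLiteral σ α (p , true)  = σ ++ [ α ] , var p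
effectLiteral σ α (p , false) = σ ++ [ α ] , ¬' var p

effectList : Label → Assignment → List LF
effectList σ α = map (effectLiteral σ α) (pairs α)

effect-weightless : ∀ σ α ps → total (map (effectLiteral σ α) ps) ≡ 0
effect-weightless σ α []                 = refl
effect-weightless σ α ((_ , true) ∷ ps)  = effect-weightless σ α ps
effect-weightless σ α ((_ , false) ∷ ps) = effect-weightless σ α ps

effect-output : ∀ {σ α x} → effects σ α x → proj₁ x ≡ σ ++ [ α ] × x ∈ effectList σ α
effect-output {σ} {α} (_ , inj₁ (i , refl)) = refl , ∈-map⁺ (effectLiteral σ α) i
effect-output {σ} {α} (_ , inj₂ (i , refl)) = refl , ∈-map⁺ (effectLiteral σ α) i

assignment-output : ∀ τ {l σ α x} (w : WA l σ α) → genA w x →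
                    proj₁ x ≡ σ ++ [ α ] × (x ∈ transfer τ l ⊎ x ∈ effectList σ α)
assignment-output τ r[α] (inj₁ refl) = refl , inj₁ (here refl)
assignment-output τ r⟨α⟩ (inj₁ refl) = refl , inj₁ (here refl)
assignment-output τ r[α] (inj₂ e)    = proj₁ (effect-output e) , inj₂ (proj₂ (effect-output e))
assignment-output τ r⟨α⟩ (inj₂ e)    = proj₁ (effect-output e) , inj₂ (proj₂ (effect-output e))

-- The list tracking the branch that step (iii) enters for (σ, α).
successors : Label → Assignment → List LF → List LF
successors σ α L = concatMap (transfer (σ ++ [ α ])) L ++ effectList σ α

successors-lighter : ∀ {l σ α L} → WA l σ α → l ∈ L → total (successors σ α L) < total L
successors-lighter {l} {σ} {α} {L} w l∈L = begin-strict
  total (successors σ α L)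
    ≡⟨ total-++ (concatMap (transfer τ) L) (effectList σ α) ⟩
  total (concatMap (transfer τ) L) + total (effectList σ α)
    ≡⟨ cong (total (concatMap (transfer τ) L) +_) (effect-weightless σ α (pairs α)) ⟩
  total (concatMap (transfer τ) L) + 0
    ≡⟨ +-identityʳ _ ⟩
  total (concatMap (transfer τ) L)
    <⟨ concatMap-lighter (transfer τ) (transfer-light τ) l∈L (transfer-strict τ w) ⟩
  total L ∎
  where
  τ : Label
  τ = σ ++ [ α ]
  open ≤-Reasoning

proper-extension : ∀ (t : Label) {a as} → t ++ a ∷ as ≢ t
proper-extension t e with ++-identityʳ-unique t (sym e)
... | ()

rp-witness : ∀ {P B : Pred} {s α₀ σ α φ ψ} → Labelled s P → Labelled (s ++ [ α₀ ]) B →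
             (P ∪ₚ B) (σ , φ) → (P ∪ₚ B) (σ ++ [ α ] , ψ) → P (σ , φ) × σ ++ [ α ] ≡ s ++ [ α₀ ]
rp-witness lp lb (inj₁ pl) (inj₂ bc) = pl , lb _ bc
rp-witness {σ = σ} lp lb (inj₁ pl) (inj₁ pc) =
  ⊥-elim (proper-extension σ (trans (lp _ pc) (sym (lp _ pl))))
rp-witness {σ = σ} lp lb (inj₂ bl) (inj₂ bc) =
  ⊥-elim (proper-extension σ (trans (lb _ bc) (sym (lb _ bl))))
rp-witness {s = s} {α₀} {σ} {α} lp lb (inj₂ bl) (inj₁ pc) = ⊥-elim (proper-extension s (begin
  s ++ α₀ ∷ [ α ]        ≡⟨ sym (++-assoc s [ α₀ ] [ α ]) ⟩
  (s ++ [ α₀ ]) ++ [ α ] ≡⟨ cong (_++ [ α ]) (sym (lb _ bl)) ⟩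
  σ ++ [ α ]             ≡⟨ lp _ pc ⟩
  s                      ∎))
  where open ≡-Reasoning

rp-step : ∀ {P B : Pred} {s α₀ l ℓ} → Labelled s P → Labelled (s ++ [ α₀ ]) B →
          (P ∪ₚ B) l → WRP (P ∪ₚ B) l ℓ →
          P l × ℓ ∈ transfer (s ++ [ α₀ ]) l × proj₁ ℓ ≡ s ++ [ α₀ ]
rp-step lp lb hl (rp1 {p = p} hc _) =
  let pl , e = rp-witness lp lb hl hc in pl , here (cong (λ τ → τ , var p) e) , e
rp-step lp lb hl (rp2 {p = p} hc _) =
  let pl , e = rp-witness lp lb hl hc in pl , here (cong (λ τ → τ , ¬' var p) e) , e

-- Each round of the loop marks an unmarked formula of P, listed in K.
closure-terminates : ∀ k {P B M : Pred} {s α₀ K} → length K < k →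
                     Labelled s P → Labelled (s ++ [ α₀ ]) B → Covers K P M → CloseTerm P B M
closure-terminates zero    ()  _  _  _
closure-terminates (suc k) len lp lb cov = cterm λ l ℓ hl unmarked rp →
  let pl , _ , ℓ-label = rp-step lp lb hl rp
      i = cov l pl unmarked
  in closure-terminates k (<-≤-trans (─-shorter i) (s≤s⁻¹ len)) lp (labelled-add lb ℓ-label)
       (covers-mark cov i)

closure-output : ∀ {P B M B' M' : Pred} {s α₀ L E} → CloseOut P B M B' M' →
                 Labelled s P → Labelled (s ++ [ α₀ ]) B → Covers L P M →
                 B ⊆ₚ ⟦ concatMap (transfer (s ++ [ α₀ ])) L ++ E ⟧ →
                 Labelled (s ++ [ α₀ ]) B' × B' ⊆ₚ ⟦ concatMap (transfer (s ++ [ α₀ ])) L ++ E ⟧ ×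
                 M ⊆ₚ M'
closure-output (cdone _) lp lb cov B⊆ = lb , B⊆ , λ _ m → m
closure-output (cstep {l = l} hl unmarked rp rest) lp lb cov B⊆ =
  let pl , ℓ∈ , ℓ-label = rp-step lp lb hl rp
      ℓ∈successors = ∈-++⁺ˡ (∈-concatMap⁺ (transfer _) (lose (cov l pl unmarked) ℓ∈))
      lb' , B'⊆ , grows = closure-output rest lp (labelled-add lb ℓ-label)
                            (covers-weaken (λ _ → inj₁) cov) (within-add B⊆ ℓ∈successors)
  in lb' , B'⊆ , λ x m → grows x (inj₁ m)

wa-label : ∀ {l σ α} → WA l σ α → proj₁ l ≡ σ
wa-label r[α] = refl
wa-label r⟨α⟩ = refl

relabelled : ∀ {b σ L l σ' α} → Tracked b σ L → WA l σ' α → App b l → Labelled σ' (mem b)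
relabelled t w (inb , _) x bx = trans (labelled t x bx) (trans (sym (labelled t _ inb)) (wa-label w))

first-round : ∀ {b σ L σ' α} → Tracked b σ L →
              B₁ b σ' α ⊆ₚ (λ x → proj₁ x ≡ σ' ++ [ α ] × x ∈ successors σ' α L)
first-round {σ' = σ'} {α} t x (l , app , w , gx) with assignment-output (σ' ++ [ α ]) w gx
... | e , inj₁ x∈transfer = e , ∈-++⁺ˡ (∈-concatMap⁺ (transfer _) (lose (position t app) x∈transfer))
... | e , inj₂ x∈effects  = e , ∈-++⁺ʳ _ x∈effects

closure-halts : ∀ {b σ L l σ' α} → Tracked b σ L → WA l σ' α → App b l →
                CloseTerm (mem b) (B₁ b σ' α) (M₁ b σ' α)
closure-halts {L = L} t w app =
  closure-terminates (suc (length L)) ≤-refl (relabelled t w app)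
    (λ x bx → proj₁ (first-round t x bx)) (covers-weaken (λ _ → inj₁) (covered t))

after-closure : ∀ {b σ L l σ' α B' M'} (t : Tracked b σ L) → WA l σ' α → (app : App b l) →
                CloseOut (mem b) (B₁ b σ' α) (M₁ b σ' α) B' M' →
                Tracked (br B' M') (σ' ++ [ α ]) (successors σ' α L) ×
                Tracked (br (mem b) M') σ (L ─ position t app)
after-closure {b} {σ' = σ'} {α} {M' = M'} t w app out =
  let lb' , B'⊆ , grows = closure-output out (relabelled t w app)
                            (λ x bx → proj₁ (first-round t x bx))
                            (covers-weaken (λ _ → inj₁) (covered t))
                            (λ x bx → proj₂ (first-round t x bx))
  in tracked lb' (λ x bx _ → B'⊆ x bx) ,
     tracked (labelled t) (covers-weaken (witness-marked grows) (covers-mark (covered t) (position t app)))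
  where
  witness-marked : M₁ b σ' α ⊆ₚ M' → (mark b ∪ₚ ｛ _ ｝) ⊆ₚ M'
  witness-marked grows x (inj₁ m)    = grows x (inj₁ m)
  witness-marked grows x (inj₂ refl) = grows x (inj₂ (app , w))

mutual
  tableau-halts : ∀ n {b σ L} → Tracked b σ L → total L < n → Halts b
  tableau-halts (suc n) {b} {L = L} t bound =
    halts (λ l w app → next app (ruleI-lighter w))
          (λ _ l w app → next app (ruleII-lighter₁ w) , λ _ → next app (ruleII-lighter₂ w))
          (λ _ _ → loop-halts n (suc (length L)) t (s≤s⁻¹ bound) ≤-refl)
    where
    next : ∀ {l G} → App b l → Lighter l G → Halts (extend b l G)
    next app lt =
      let _ , t' , decreased = extend-tracked t app lt
      in tableau-halts n t' (<-≤-trans decreased (s≤s⁻¹ bound))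

  loop-halts : ∀ m k {b σ L} → Tracked b σ L → total L ≤ m → length L < k → LoopHalts b
  loop-halts m (suc k) t bound len = lhalts λ l σ' α w app →
    let i = position t app in
    closure-halts t w app ,
    λ B' M' out →
      let child , rest = after-closure t w app out in
      tableau-halts m child (<-≤-trans (successors-lighter w i) bound) ,
      λ _ → loop-halts m k rest (≤-trans (total-─-≤ i) bound) (<-≤-trans (─-shorter i) (s≤s⁻¹ len))

initial-list : Form → List LF
initial-list φ₀ =
  ([] , φ₀) ∷ map (λ p → [] , var p) (varsF φ₀) ++ map (λ p → [] , ¬' var p) (varsF φ₀)

initial-tracked : ∀ V φ₀ → Tracked (b₀ V φ₀) [] (initial-list φ₀)
initial-tracked V φ₀ = tracked labelled₀ covered₀
  where
  labelled₀ : Labelled [] (mem (b₀ V φ₀))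
  labelled₀ _ (inj₁ refl)                      = refl
  labelled₀ _ (inj₂ (inj₁ (_ , _ , _ , refl))) = refl
  labelled₀ _ (inj₂ (inj₂ (_ , _ , _ , refl))) = refl
  covered₀ : Covers (initial-list φ₀) (mem (b₀ V φ₀)) ∅
  covered₀ _ (inj₁ refl) _ = here refl
  covered₀ _ (inj₂ (inj₁ (p , p∈φ₀ , _ , refl))) _ =
    there (∈-++⁺ˡ (∈-map⁺ (λ p → [] , var p) p∈φ₀))
  covered₀ _ (inj₂ (inj₂ (p , p∈φ₀ , _ , refl))) _ =
    there (∈-++⁺ʳ (map (λ p → [] , var p) (varsF φ₀)) (∈-map⁺ (λ p → [] , ¬' var p) p∈φ₀))

theorem3 : (V : List ℕ) (φ₀ : Form) → StarFreeF φ₀ → Halts (b₀ V φ₀)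
theorem3 V φ₀ _ = tableau-halts (suc (total (initial-list φ₀))) (initial-tracked V φ₀) ≤-refl
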